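{- Let $R$ be a strictly dense set of rooted triples on $L_R$, and let $L'=\{a,b,c,d\}\subseteq L_R$ be any set of four distinct leaves. Consider the following inference rules, applied to triples of $R$ whose leaf sets are contained in $L'$ (with $a,b,c,d$ ranging over all labelings of the elements of $L'$): (i) from $(ab|c)$ and $(ad|c)$ infer $(bd|c)$; (ii) from $(ab|c)$ and $(ad|b)$ infer $(bd|c)$ and $(ad|c)$; (iii) from $(ab|c)$ and $(cd|b)$ infer $(ab|d)$ and $(cd|a)$. Then all triples inferred by rule (ii) from triples $r\in R$ with $L_r\subset L'$ are contained in $R$ if and only if all triples inferred by rule (iii) from triples $r\in R$ with $L_r\subset L'$ are contained in $R$. Moreover, if all triples inferred by rule (ii) from triples $r\in R$ with $L_r\subset L'$ are contained in $R$, then all triples inferred by rule (i) from triples $r\in R$ with $L_r\subset L'$ are contained in $R$.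
   Context: A rooted triple $(xy|z)$ on three distinct leaves $x,y,z$ (with $(xy|z)=(yx|z)$) has leaf set $L_r=\{x,y,z\}$. For a set $R$ of triples, $L_R=\bigcup_{r\in R}L_r$. $R$ is strictly dense (on $L_R$) if for each 3-element subset $\{x,y,z\}\subseteq L_R$ there is exactly one triple $r\in R$ with $L_r=\{x,y,z\}$. -}

module Defs where

open import Level using (Level; _⊔_; suc)
open import Data.Product using (Σ; ∃; _×_; _,_)
open import Data.Sum using (_⊎_)
open import Relation.Binary.PropositionalEquality using (_≡_)
open import Relation.Nullary using (¬_)

-- A rooted triple (xy|z) over a leaf type A, stored as the ordered data (x , y , z).
-- The identification (xy|z) = (yx|z) is handled by the relation _≈ₜ_ below.
record Triple (A : Set) : Set where
  constructor ⟨_,_∣_⟩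
  field
    x y z : A
open Triple public

_≈ₜ_ : {A : Set} → Triple A → Triple A → Set
t ≈ₜ u = (z t ≡ z u) × ((x t ≡ x u × y t ≡ y u) ⊎ (x t ≡ y u × y t ≡ x u))

Distinct3 : {A : Set} → A → A → A → Set
Distinct3 a b c = ¬ a ≡ b × ¬ a ≡ c × ¬ b ≡ c

IsTriple : {A : Set} → Triple A → Set
IsTriple t = Distinct3 (x t) (y t) (z t)

_∈L_ : {A : Set} → A → Triple A → Set
w ∈L t = w ≡ x t ⊎ w ≡ y t ⊎ w ≡ z t

TripleSet : Set → Set₁
TripleSet A = Triple A → Set

WellFormed : {A : Set} → TripleSet A → Set
WellFormed R = ∀ t → R t → IsTriple t

_∈LR_ : {A : Set} → A → TripleSet A → Set
w ∈LR R = Σ _ λ t → R t × w ∈L t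

LeafSetIs : {A : Set} → Triple A → A → A → A → Set
LeafSetIs t a b c = ∀ w → (w ∈L t → (w ≡ a ⊎ w ≡ b ⊎ w ≡ c)) × ((w ≡ a ⊎ w ≡ b ⊎ w ≡ c) → w ∈L t)

StrictlyDense : {A : Set} → TripleSet A → Set
StrictlyDense R = ∀ a b c → a ∈LR R → b ∈LR R → c ∈LR R → Distinct3 a b c →
  (Σ _ λ t → R t × LeafSetIs t a b c) ×
  (∀ t u → R t → R u → LeafSetIs t a b c → LeafSetIs u a b c → t ≈ₜ u)

-- (pq|r) ∈ R, respecting (pq|r) = (qp|r)
Has : {A : Set} → TripleSet A → A → A → A → Set
Has R p q r = R ⟨ p , q ∣ r ⟩ ⊎ R ⟨ q , p ∣ r ⟩

InL' : {A : Set} → A → A → A → A → A → Set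
InL' a b c d w = w ≡ a ⊎ w ≡ b ⊎ w ≡ c ⊎ w ≡ d

Labelling : {A : Set} → (a b c d p q r s : A) → Set
Labelling a b c d p q r s =
  (InL' a b c d p × InL' a b c d q × InL' a b c d r × InL' a b c d s) ×
  (¬ p ≡ q × ¬ p ≡ r × ¬ p ≡ s × ¬ q ≡ r × ¬ q ≡ s × ¬ r ≡ s)

Closed-i : {A : Set} → TripleSet A → (a b c d : A) → Set
Closed-i R a b c d = ∀ p q r s → Labelling a b c d p q r s →
  Has R p q r → Has R p s r → Has R q s r

Closed-ii : {A : Set} → TripleSet A → (a b c d : A) → Set
Closed-ii R a b c d = ∀ p q r s → Labelling a b c d p q r s →
  Has R p q r → Has R p s q → Has R q s r × Has R p s r

Closed-iii : {A : Set} → TripleSet A → (a b c d : A) → Set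
Closed-iii R a b c d = ∀ p q r s → Labelling a b c d p q r s →
  Has R p q r → Has R r s q → Has R p q s × Has R r s p

-- By strict density, any three leaves of L' carry exactly one triple of R, so
-- a triple on them follows once the two other possible roots are excluded.
-- Between (ii) and (iii), each excluded alternative, fed with the premises into
-- the assumed rule, yields a triple on the leaf set of a known triple but with a
-- different root. For (ii) ⇒ (i), whichever triple R holds on {p, q, s}, rule
-- (ii) applied to it and a premise already gives (qs|r).
module Submission where

open import Defs
open import Data.Product using (_×_; _,_; Σ; proj₁; proj₂; map)
open import Data.Sum using (_⊎_; inj₁; inj₂; swap; map₁; map₂; assocˡ; assocʳ)
open import Data.Empty using (⊥; ⊥-elim)
open import Function using (_∘_)
open import Relation.Binary.PropositionalEquality using (_≡_; refl; sym; ≢-sym)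
open import Relation.Nullary using (¬_)

private
  variable
    A : Set
    B C D : Set
    p q r s u v w : A
    t : Triple A

⊎-swap₁₂ : B ⊎ C ⊎ D → C ⊎ B ⊎ D
⊎-swap₁₂ = assocʳ ∘ map₁ swap ∘ assocˡ

LeafSetIs-swap₁₂ : LeafSetIs t p q r → LeafSetIs t q p r
LeafSetIs-swap₁₂ ls w = map (⊎-swap₁₂ ∘_) (_∘ ⊎-swap₁₂) (ls w)

LeafSetIs-swap₂₃ : LeafSetIs t p q r → LeafSetIs t p r q
LeafSetIs-swap₂₃ ls w = map (map₂ swap ∘_) (_∘ map₂ swap) (ls w)

LeafSetIs-refl : LeafSetIs ⟨ p , q ∣ r ⟩ p q r
LeafSetIs-refl w = (λ w∈ → w∈) , (λ w∈ → w∈)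

Has-witness : {R : TripleSet A} → Has R p q r →
  Σ (Triple A) λ t → R t × LeafSetIs t p q r × z t ≡ r
Has-witness (inj₁ Rt) = _ , Rt , LeafSetIs-refl , refl
Has-witness (inj₂ Rt) = _ , Rt , LeafSetIs-swap₁₂ LeafSetIs-refl , refl

Has-of-leafSet : {R : TripleSet A} → Distinct3 u v w → R ⟨ u , v ∣ w ⟩ →
  LeafSetIs ⟨ u , v ∣ w ⟩ p q r → Has R p q r ⊎ Has R p r q ⊎ Has R q r p
Has-of-leafSet {u = u} {v} {w} (u≢v , u≢w , v≢w) Rt ls
  with proj₁ (ls u) (inj₁ refl) | proj₁ (ls v) (inj₂ (inj₁ refl)) | proj₁ (ls w) (inj₂ (inj₂ refl))
... | inj₁ refl        | inj₂ (inj₁ refl) | inj₂ (inj₂ refl) = inj₁ (inj₁ Rt)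
... | inj₂ (inj₁ refl) | inj₁ refl        | inj₂ (inj₂ refl) = inj₁ (inj₂ Rt)
... | inj₁ refl        | inj₂ (inj₂ refl) | inj₂ (inj₁ refl) = inj₂ (inj₁ (inj₁ Rt))
... | inj₂ (inj₂ refl) | inj₁ refl        | inj₂ (inj₁ refl) = inj₂ (inj₁ (inj₂ Rt))
... | inj₂ (inj₁ refl) | inj₂ (inj₂ refl) | inj₁ refl        = inj₂ (inj₂ (inj₁ Rt))
... | inj₂ (inj₂ refl) | inj₂ (inj₁ refl) | inj₁ refl        = inj₂ (inj₂ (inj₂ Rt))
... | inj₁ refl        | inj₁ refl        | _                = ⊥-elim (u≢v refl)
... | inj₂ (inj₁ refl) | inj₂ (inj₁ refl) | _                = ⊥-elim (u≢v refl)
... | inj₂ (inj₂ refl) | inj₂ (inj₂ refl) | _                = ⊥-elim (u≢v refl)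
... | inj₁ refl        | _                | inj₁ refl        = ⊥-elim (u≢w refl)
... | inj₂ (inj₁ refl) | _                | inj₂ (inj₁ refl) = ⊥-elim (u≢w refl)
... | inj₂ (inj₂ refl) | _                | inj₂ (inj₂ refl) = ⊥-elim (u≢w refl)
... | _                | inj₁ refl        | inj₁ refl        = ⊥-elim (v≢w refl)
... | _                | inj₂ (inj₁ refl) | inj₂ (inj₁ refl) = ⊥-elim (v≢w refl)
... | _                | inj₂ (inj₂ refl) | inj₂ (inj₂ refl) = ⊥-elim (v≢w refl)

Has-resolved : {R : TripleSet A} → WellFormed R → StrictlyDense R →
  p ∈LR R → q ∈LR R → r ∈LR R → Distinct3 p q r →
  Has R p q r ⊎ Has R p r q ⊎ Has R q r p
Has-resolved {p = p} {q} {r} wf dense p∈ q∈ r∈ pqr with proj₁ (dense p q r p∈ q∈ r∈ pqr)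
... | t , Rt , ls = Has-of-leafSet (wf _ Rt) Rt ls

Has-root-unique : {R : TripleSet A} → StrictlyDense R →
  p ∈LR R → q ∈LR R → r ∈LR R → Distinct3 p q r →
  Has R p q r → Has R p r q → r ≡ q
Has-root-unique {p = p} {q} {r} {R = R} dense p∈ q∈ r∈ pqr hr hq
  with Has-witness {R = R} hr | Has-witness {R = R} hq
... | t , Rt , lt , refl | u , Ru , lu , refl =
  proj₁ (proj₂ (dense p q r p∈ q∈ r∈ pqr) t u Rt Ru lt (LeafSetIs-swap₂₃ lu))

Has-exclusive : {R : TripleSet A} → StrictlyDense R →
  p ∈LR R → q ∈LR R → r ∈LR R → Distinct3 p q r →
  Has R p q r → Has R p r q → ⊥
Has-exclusive dense p∈ q∈ r∈ pqr@(_ , _ , q≢r) hr hq =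
  q≢r (sym (Has-root-unique dense p∈ q∈ r∈ pqr hr hq))

module Quartet {R : TripleSet A} (wf : WellFormed R) (dense : StrictlyDense R)
  (a b c d : A) (a∈ : a ∈LR R) (b∈ : b ∈LR R) (c∈ : c ∈LR R) (d∈ : d ∈LR R) where

  L' : A → Set
  L' = InL' a b c d

  Lab : A → A → A → A → Set
  Lab = Labelling a b c d

  Has-comm : Has R p q r → Has R q p r
  Has-comm = swap

  swap₁₂ : Lab p q r s → Lab q p r s
  swap₁₂ ((p∈ , q∈ , r∈ , s∈) , (p≢q , p≢r , p≢s , q≢r , q≢s , r≢s)) =
    (q∈ , p∈ , r∈ , s∈) , (≢-sym p≢q , q≢r , q≢s , p≢r , p≢s , r≢s)

  swap₂₃ : Lab p q r s → Lab p r q s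
  swap₂₃ ((p∈ , q∈ , r∈ , s∈) , (p≢q , p≢r , p≢s , q≢r , q≢s , r≢s)) =
    (p∈ , r∈ , q∈ , s∈) , (p≢r , p≢q , p≢s , ≢-sym q≢r , r≢s , q≢s)

  swap₃₄ : Lab p q r s → Lab p q s r
  swap₃₄ ((p∈ , q∈ , r∈ , s∈) , (p≢q , p≢r , p≢s , q≢r , q≢s , r≢s)) =
    (p∈ , q∈ , s∈ , r∈) , (p≢q , p≢s , p≢r , q≢s , q≢r , ≢-sym r≢s)

  reverse : Lab p q r s → Lab s r q p
  reverse ((p∈ , q∈ , r∈ , s∈) , (p≢q , p≢r , p≢s , q≢r , q≢s , r≢s)) =
    (s∈ , r∈ , q∈ , p∈) , (≢-sym r≢s , ≢-sym q≢s , ≢-sym p≢s , ≢-sym q≢r , ≢-sym p≢r , ≢-sym p≢q)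

  ∈LR-of-L' : L' w → w ∈LR R
  ∈LR-of-L' (inj₁ refl)               = a∈
  ∈LR-of-L' (inj₂ (inj₁ refl))        = b∈
  ∈LR-of-L' (inj₂ (inj₂ (inj₁ refl))) = c∈
  ∈LR-of-L' (inj₂ (inj₂ (inj₂ refl))) = d∈

  resolved : L' p → L' q → L' r → Distinct3 p q r → Has R p q r ⊎ Has R p r q ⊎ Has R q r p
  resolved p∈ q∈ r∈ = Has-resolved wf dense (∈LR-of-L' p∈) (∈LR-of-L' q∈) (∈LR-of-L' r∈)

  exclusive : L' p → L' q → L' r → Distinct3 p q r → Has R p q r → Has R p r q → ⊥
  exclusive p∈ q∈ r∈ = Has-exclusive dense (∈LR-of-L' p∈) (∈LR-of-L' q∈) (∈LR-of-L' r∈)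

  ii⇒iii-first : Closed-ii R a b c d → Lab p q r s → Has R p q r → Has R r s q → Has R p q s
  ii⇒iii-first {p} {q} {r} {s} ii L@((p∈ , q∈ , r∈ , s∈) , (p≢q , _ , p≢s , q≢r , q≢s , r≢s)) pq∣r rs∣q
    with resolved p∈ q∈ s∈ (p≢q , p≢s , q≢s)
  ... | inj₁ pq∣s = pq∣s
  ... | inj₂ alternative =
    ⊥-elim (exclusive s∈ q∈ r∈ (≢-sym q≢s , ≢-sym r≢s , q≢r) (Has-comm (qs∣r alternative)) (Has-comm rs∣q))
    where
    qs∣r : Has R p s q ⊎ Has R q s p → Has R q s r
    qs∣r (inj₁ ps∣q) = proj₁ (ii p q r s L pq∣r ps∣q)
    qs∣r (inj₂ qs∣p) = proj₂ (ii q p r s (swap₁₂ L) (Has-comm pq∣r) qs∣p)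

  ii⇒iii : Closed-ii R a b c d → Closed-iii R a b c d
  ii⇒iii ii p q r s L pq∣r rs∣q =
    ii⇒iii-first ii L pq∣r rs∣q , Has-comm (ii⇒iii-first ii (reverse L) (Has-comm rs∣q) (Has-comm pq∣r))

  iii⇒ii : Closed-iii R a b c d → Closed-ii R a b c d
  iii⇒ii iii p q r s L@((p∈ , q∈ , r∈ , s∈) , (p≢q , p≢r , p≢s , q≢r , q≢s , r≢s)) pq∣r ps∣q = qs∣r , ps∣r
    where
    qs∣r : Has R q s r
    qs∣r with resolved q∈ s∈ r∈ (q≢s , q≢r , ≢-sym r≢s)
    ... | inj₁ qs∣r = qs∣r
    ... | inj₂ (inj₁ qr∣s) = ⊥-elim (exclusive q∈ r∈ p∈ (q≢r , ≢-sym p≢q , ≢-sym p≢r)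
            (proj₂ (iii p s q r (swap₂₃ (swap₃₄ L)) ps∣q qr∣s)) (Has-comm pq∣r))
    ... | inj₂ (inj₂ sr∣q) = ⊥-elim (exclusive p∈ q∈ s∈ (p≢q , p≢s , q≢s)
            (proj₁ (iii p q r s L pq∣r (Has-comm sr∣q))) ps∣q)
    ps∣r : Has R p s r
    ps∣r with resolved p∈ s∈ r∈ (p≢s , p≢r , ≢-sym r≢s)
    ... | inj₁ ps∣r = ps∣r
    ... | inj₂ (inj₁ pr∣s) = ⊥-elim (exclusive p∈ q∈ r∈ (p≢q , p≢r , q≢r)
            pq∣r (proj₁ (iii p r s q (swap₃₄ (swap₂₃ L)) pr∣s (Has-comm qs∣r))))
    ... | inj₂ (inj₂ sr∣p) = ⊥-elim (exclusive s∈ q∈ r∈ (≢-sym q≢s , ≢-sym r≢s , q≢r)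
            (Has-comm qs∣r) (Has-comm (proj₂ (iii q p r s (swap₁₂ L) (Has-comm pq∣r) (Has-comm sr∣p)))))

  ii⇒i : Closed-ii R a b c d → Closed-i R a b c d
  ii⇒i ii p q r s L@((p∈ , q∈ , _ , s∈) , (p≢q , _ , p≢s , _ , q≢s , _)) pq∣r ps∣r
    with resolved p∈ q∈ s∈ (p≢q , p≢s , q≢s)
  ... | inj₁ pq∣s = Has-comm (proj₁ (ii p s r q (swap₂₃ (swap₃₄ (swap₂₃ L))) ps∣r pq∣s))
  ... | inj₂ (inj₁ ps∣q) = proj₁ (ii p q r s L pq∣r ps∣q)
  ... | inj₂ (inj₂ qs∣p) = proj₂ (ii q p r s (swap₁₂ L) (Has-comm pq∣r) qs∣p)

lemma4 : {A : Set} (R : TripleSet A) → WellFormed R → StrictlyDense R →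
    (a b c d : A) → a ∈LR R → b ∈LR R → c ∈LR R → d ∈LR R →
    ¬ a ≡ b → ¬ a ≡ c → ¬ a ≡ d → ¬ b ≡ c → ¬ b ≡ d → ¬ c ≡ d →
    ((Closed-ii R a b c d → Closed-iii R a b c d) × (Closed-iii R a b c d → Closed-ii R a b c d)) ×
    (Closed-ii R a b c d → Closed-i R a b c d)
lemma4 R wf dense a b c d a∈ b∈ c∈ d∈ _ _ _ _ _ _ = (ii⇒iii , iii⇒ii) , ii⇒i
  where open Quartet wf dense a b c d a∈ b∈ c∈ d∈
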